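{- Let $D=(V,A)$ be an acyclic digraph with $V\subset\mathbb{Z}^+$, $|V|=n\ge3$, let $a$ be a turning vertex of $D$, and let $r\in\mathbb{Z}^+\setminus V$ satisfy $r>\max\mathcal{P}_D(a)$ if $F_D(a)=\emptyset$, and $\min F_D(a)>r>\max\mathcal{P}_D(a)$ otherwise. Then no member of $\mathcal{W}(D_{a\rightarrow r})$ contains $r$, and consequently $\mathcal{W}(D_{a\rightarrow r})=\mathcal{W}(D-a)$.
   Context: $F_D(u)=\{v:(u,v)\in A\}$, $B_D(u)=\{v:(v,u)\in A\}$, $B_D[u]=B_D(u)\cup\{u\}$, and $\mathcal{P}_D(u)=B_D[u]\cup\{c\in V:\exists b<c,\ (c,b)\in A\}$. A vertex $u$ is a turning vertex if $F_D(u)=\emptyset$ or $\min F_D(u)\ge 2+\max\mathcal{P}_D(u)$. $D_{a\rightarrow r}$ is obtained from $D$ by relabeling vertex $a$ as $r$; $D-a$ by deleting $a$. For an acyclic digraph $H$ with vertex set a finite set of positive integers, write $u\prec_H v$ if $H$ has a directed path from $u$ to $v$, and $u\not\approx_H v$ if neither $u\prec_H v$ nor $v\prec_H u$; $\mathcal{W}(H)$ is the set of $3$-element vertex subsets $\{a,b,c\}$ with $a<b<c$, $(c,a)$ an arc of $H$, $a\not\approx_H b$ and $c\not\approx_H b$. -}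

module Defs where

open import Data.Nat using (ℕ; _<_; _≤_; _+_; _≟_)
open import Data.Product using (_×_; _,_; Σ; ∃; ∃-syntax)
open import Data.List using (List; map; filter; length)
open import Data.List.Membership.Propositional using (_∈_; _∉_)
open import Data.List.Relation.Unary.All using (All)
open import Data.List.Relation.Unary.Unique.Propositional using (Unique)
open import Data.Sum using (_⊎_)
open import Data.Empty using (⊥)
open import Relation.Nullary using (¬_; ¬?)
open import Relation.Nullary.Decidable using (_×-dec_)
open import Relation.Binary.PropositionalEquality using (_≡_; _≢_)
open import Relation.Binary.Construct.Closure.Transitive using (TransClosure)

-- A digraph D = (V, A): a finite vertex set (a duplicate-free list, enforced
-- separately by the hypothesis `Unique (V D)`) and a list of arcs.
record Digraph : Set where
  constructor mkDigraph
  field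
    V : List ℕ
    A : List (ℕ × ℕ)
open Digraph public

Arc : Digraph → ℕ → ℕ → Set
Arc D u v = (u , v) ∈ A D

WellFormed : Digraph → Set
WellFormed D = Unique (V D) × All (λ x → 0 < x) (V D)
             × (∀ u v → Arc D u v → u ∈ V D × v ∈ V D)

_≺[_]_ : ℕ → Digraph → ℕ → Set
u ≺[ H ] v = TransClosure (Arc H) u v

Acyclic : Digraph → Set
Acyclic D = ∀ u → ¬ (u ≺[ D ] u)

Incomparable : Digraph → ℕ → ℕ → Set
Incomparable H u v = ¬ (u ≺[ H ] v) × ¬ (v ≺[ H ] u)

InF : Digraph → ℕ → ℕ → Set
InF D u v = Arc D u v

InBclosed : Digraph → ℕ → ℕ → Set
InBclosed D u v = Arc D v u ⊎ v ≡ u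

InP : Digraph → ℕ → ℕ → Set
InP D u x = InBclosed D u x ⊎ (x ∈ V D × ∃[ b ] (b < x × Arc D x b))

FEmpty : Digraph → ℕ → Set
FEmpty D u = ∀ v → ¬ InF D u v

-- Turning vertex: F_D(u) = ∅ or min F_D(u) ≥ 2 + max 𝒫_D(u)
-- (the min/max comparison unfolded pointwise; 𝒫_D(u) ∋ u is nonempty).
Turning : Digraph → ℕ → Set
Turning D u = FEmpty D u ⊎ (∀ f p → InF D u f → InP D u p → 2 + p ≤ f)

relabel : ℕ → ℕ → ℕ → ℕ
relabel a r x with x ≟ a
... | Relation.Nullary.yes _ = r
... | Relation.Nullary.no _ = x

relabelArc : ℕ → ℕ → ℕ × ℕ → ℕ × ℕ
relabelArc a r (u , v) = (relabel a r u , relabel a r v)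

_[_↦_] : Digraph → ℕ → ℕ → Digraph
D [ a ↦ r ] = mkDigraph (map (relabel a r) (V D)) (map (relabelArc a r) (A D))

_minus_ : Digraph → ℕ → Digraph
D minus a = mkDigraph (filter (λ x → ¬? (x ≟ a)) (V D))
                      (filter (λ e → ¬? (Data.Product.proj₁ e ≟ a) ×-dec ¬? (Data.Product.proj₂ e ≟ a)) (A D))

-- {x,y,z} ∈ 𝒲(H), written with its elements in increasing order x < y < z.
InW : Digraph → ℕ → ℕ → ℕ → Set
InW H x y z = x ∈ V H × y ∈ V H × z ∈ V H × x < y × y < z
            × Arc H z x × Incomparable H x y × Incomparable H z y

-- Idea: because r lies strictly above 𝒫_D(a) and strictly below F_D(a), every
-- arc of D_{a→r} leaving a vertex ≥ r ends above r (arcs out of r are the arcs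
-- out of a; an arc out of some c > r can neither enter a nor descend, as either
-- would put c in 𝒫_D(a)).  Hence a directed path ending below r never visits r,
-- so reachability among vertices below r is the same in D_{a→r} and D − a.  In
-- a member {x, y, z} of 𝒲 the descending arc (z, x) puts z in 𝒫_D(a), so all
-- three vertices lie below r and the two digraphs have the same members of 𝒲.
module Submission where

open import Defs
open import Data.Nat using (ℕ; _<_; _≤_; _≟_; _<?_)
open import Data.Nat.Properties
  using (≤-refl; <⇒≤; <-irrefl; <-asym; <-trans; <-≤-trans; <⇒≢; <⇒≱; ≮⇒≥; ≤∧≢⇒<)
open import Data.Product using (_×_; _,_; proj₁; proj₂; ∃; ∃₂)
open import Data.Sum using (inj₁; inj₂)
open import Data.Empty using (⊥-elim)
open import Data.List using (List; length; map)
open import Data.List.Membership.Propositional using (_∈_; _∉_)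
open import Data.List.Membership.Propositional.Properties
  using (∈-map⁺; ∈-map⁻; ∈-filter⁺; ∈-filter⁻)
open import Relation.Nullary using (¬_; ¬?; yes; no)
open import Relation.Nullary.Decidable using (_×-dec_)
open import Relation.Binary.PropositionalEquality
  using (_≡_; _≢_; refl; sym; subst; cong₂)
open import Relation.Binary.Construct.Closure.Transitive using ([_]; _∷_)
open import Function.Bundles using (_⇔_; mk⇔)

data Relabelled (a r x : ℕ) : ℕ → Set where
  hit  : x ≡ a → Relabelled a r x r
  miss : x ≢ a → Relabelled a r x x

relabel-view : ∀ a r x → Relabelled a r x (relabel a r x)
relabel-view a r x with x ≟ a
... | yes x≡a = hit x≡a
... | no x≢a = miss x≢a

relabel-≢ : ∀ {a r x} → x ≢ a → relabel a r x ≡ x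
relabel-≢ {a} {r} {x} x≢a with x ≟ a
... | yes x≡a = ⊥-elim (x≢a x≡a)
... | no _ = refl

∈-map-relabel⁻ : ∀ {a r x} {xs : List ℕ} → x ∈ map (relabel a r) xs →
                 ∃ λ y → y ∈ xs × Relabelled a r y x
∈-map-relabel⁻ {a} {r} m with ∈-map⁻ (relabel a r) m
... | y , y∈xs , refl = y , y∈xs , relabel-view a r y

module Relabelling (D : Digraph) (a r : ℕ) where

  Arc-minus⁺ : ∀ {u v} → Arc D u v → u ≢ a → v ≢ a → Arc (D minus a) u v
  Arc-minus⁺ e u≢a v≢a =
    ∈-filter⁺ (λ e → ¬? (proj₁ e ≟ a) ×-dec ¬? (proj₂ e ≟ a)) e (u≢a , v≢a)

  Arc-minus⁻ : ∀ {u v} → Arc (D minus a) u v → Arc D u v × u ≢ a × v ≢ a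
  Arc-minus⁻ e with ∈-filter⁻ (λ e → ¬? (proj₁ e ≟ a) ×-dec ¬? (proj₂ e ≟ a)) e
  ... | e′ , u≢a , v≢a = e′ , u≢a , v≢a

  Arc-relabel⁻ : ∀ {u v} → Arc (D [ a ↦ r ]) u v →
                 ∃₂ λ p q → Arc D p q × Relabelled a r p u × Relabelled a r q v
  Arc-relabel⁻ e with ∈-map⁻ (relabelArc a r) e
  ... | (p , q) , e′ , refl = p , q , e′ , relabel-view a r p , relabel-view a r q

  Arc-minus⇒Arc-relabel : ∀ {u v} → Arc (D minus a) u v → Arc (D [ a ↦ r ]) u v
  Arc-minus⇒Arc-relabel e with Arc-minus⁻ e
  ... | e′ , u≢a , v≢a =
    subst (_∈ A (D [ a ↦ r ])) (cong₂ _,_ (relabel-≢ u≢a) (relabel-≢ v≢a))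
          (∈-map⁺ (relabelArc a r) e′)

  Arc-relabel⇒Arc-minus : ∀ {u v} → Arc (D [ a ↦ r ]) u v → u ≢ r → v ≢ r →
                          Arc (D minus a) u v
  Arc-relabel⇒Arc-minus e u≢r v≢r with Arc-relabel⁻ e
  ... | _ , _ , _  , hit _      , _          = ⊥-elim (u≢r refl)
  ... | _ , _ , _  , miss _     , hit _      = ⊥-elim (v≢r refl)
  ... | _ , _ , e′ , miss p≢a   , miss q≢a   = Arc-minus⁺ e′ p≢a q≢a

  ≺-minus⇒≺-relabel : ∀ {u v} → u ≺[ D minus a ] v → u ≺[ D [ a ↦ r ] ] v
  ≺-minus⇒≺-relabel [ e ]      = [ Arc-minus⇒Arc-relabel e ]
  ≺-minus⇒≺-relabel (e ∷ path) = Arc-minus⇒Arc-relabel e ∷ ≺-minus⇒≺-relabel path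

  Incomparable-relabel⇒minus : ∀ {x y} → Incomparable (D [ a ↦ r ]) x y →
                               Incomparable (D minus a) x y
  Incomparable-relabel⇒minus (x⊀y , y⊀x) =
    (λ p → x⊀y (≺-minus⇒≺-relabel p)) , (λ p → y⊀x (≺-minus⇒≺-relabel p))

  V-minus⇒V-relabel : ∀ {x} → x ∈ V (D minus a) → x ∈ V (D [ a ↦ r ])
  V-minus⇒V-relabel {x} m with ∈-filter⁻ (λ x → ¬? (x ≟ a)) m
  ... | x∈V , x≢a = subst (_∈ V (D [ a ↦ r ])) (relabel-≢ x≢a) (∈-map⁺ (relabel a r) x∈V)

  V-relabel⇒V-minus : ∀ {x} → x ∈ V (D [ a ↦ r ]) → x ≢ r → x ∈ V (D minus a)
  V-relabel⇒V-minus m x≢r with ∈-map-relabel⁻ m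
  ... | _ , _   , hit _    = ⊥-elim (x≢r refl)
  ... | _ , y∈V , miss y≢a = ∈-filter⁺ (λ x → ¬? (x ≟ a)) y∈V y≢a

module BetweenPredecessorsAndSuccessors
  (D : Digraph) (wf : WellFormed D) (a r : ℕ) (r∉V : r ∉ V D)
  (𝒫<r : ∀ p → InP D a p → p < r) (r<F : ∀ f → InF D a f → r < f) where

  open Relabelling D a r

  private
    D′ = D [ a ↦ r ]
    D-a = D minus a

  source∈V : ∀ {u v} → Arc D u v → u ∈ V D
  source∈V {u} {v} e = proj₁ (proj₂ (proj₂ wf) u v e)

  ¬Arc-a-a : ¬ Arc D a a
  ¬Arc-a-a e = <-asym (r<F a e) (𝒫<r a (inj₁ (inj₂ refl)))

  descending⇒<r : ∀ {c b} → Arc D c b → b < c → c < r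
  descending⇒<r {c} {b} e b<c = 𝒫<r c (inj₂ (source∈V e , b , b<c , e))

  Arc-relabel-above : ∀ {u w} → Arc D′ u w → r ≤ u → r < w
  Arc-relabel-above e r≤u with Arc-relabel⁻ e
  ... | _ , _ , e′ , hit refl , hit refl = ⊥-elim (¬Arc-a-a e′)
  ... | _ , q , e′ , hit refl , miss _   = r<F q e′
  ... | p , _ , e′ , miss _   , hit refl = ⊥-elim (<⇒≱ (𝒫<r p (inj₁ (inj₁ e′))) r≤u)
  ... | p , q , e′ , miss _   , miss _   with q <? p
  ...   | yes q<p = ⊥-elim (<⇒≱ (descending⇒<r e′ q<p) r≤u)
  ...   | no q≮p  = <-≤-trans r<p (≮⇒≥ q≮p)
    where
    r<p : r < p
    r<p = ≤∧≢⇒< r≤u (λ r≡p → r∉V (subst (_∈ V D) (sym r≡p) (source∈V e′)))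

  ≺-relabel-above : ∀ {u v} → u ≺[ D′ ] v → r ≤ u → r < v
  ≺-relabel-above [ e ]      r≤u = Arc-relabel-above e r≤u
  ≺-relabel-above (e ∷ path) r≤u = ≺-relabel-above path (<⇒≤ (Arc-relabel-above e r≤u))

  ≺-relabel⇒≺-minus : ∀ {u v} → u ≺[ D′ ] v → u ≢ r → v < r → u ≺[ D-a ] v
  ≺-relabel⇒≺-minus [ e ] u≢r v<r = [ Arc-relabel⇒Arc-minus e u≢r (<⇒≢ v<r) ]
  ≺-relabel⇒≺-minus (_∷_ {y = w} e path) u≢r v<r with w ≟ r
  ... | yes refl = ⊥-elim (<-asym v<r (≺-relabel-above path ≤-refl))
  ... | no w≢r   = Arc-relabel⇒Arc-minus e u≢r w≢r ∷ ≺-relabel⇒≺-minus path w≢r v<r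

  Incomparable-minus⇒relabel : ∀ {x y} → x < r → y < r → Incomparable D-a x y →
                               Incomparable D′ x y
  Incomparable-minus⇒relabel x<r y<r (x⊀y , y⊀x) =
    (λ p → x⊀y (≺-relabel⇒≺-minus p (<⇒≢ x<r) y<r)) ,
    (λ p → y⊀x (≺-relabel⇒≺-minus p (<⇒≢ y<r) x<r))

  InW-relabel-avoids : ∀ x y z → InW D′ x y z → x ≢ r × y ≢ r × z ≢ r
  InW-relabel-avoids x y z (_ , _ , _ , x<y , y<z , e , _) = x≢r , y≢r , z≢r
    where
    x<z : x < z
    x<z = <-trans x<y y<z
    z≢r : z ≢ r
    z≢r refl = <-asym x<z (Arc-relabel-above e ≤-refl)
    x≢r : x ≢ r
    x≢r refl = <-irrefl refl (Arc-relabel-above e (<⇒≤ x<z))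
    z<r : z < r
    z<r = descending⇒<r (proj₁ (Arc-minus⁻ (Arc-relabel⇒Arc-minus e z≢r x≢r))) x<z
    y≢r : y ≢ r
    y≢r = <⇒≢ (<-trans y<z z<r)

  InW-relabel⇒InW-minus : ∀ x y z → InW D′ x y z → InW D-a x y z
  InW-relabel⇒InW-minus x y z w@(x∈V , y∈V , z∈V , x<y , y<z , e , x≉y , z≉y)
    with InW-relabel-avoids x y z w
  ... | x≢r , y≢r , z≢r =
    V-relabel⇒V-minus x∈V x≢r , V-relabel⇒V-minus y∈V y≢r , V-relabel⇒V-minus z∈V z≢r ,
    x<y , y<z , Arc-relabel⇒Arc-minus e z≢r x≢r ,
    Incomparable-relabel⇒minus x≉y , Incomparable-relabel⇒minus z≉y

  InW-minus⇒InW-relabel : ∀ x y z → InW D-a x y z → InW D′ x y z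
  InW-minus⇒InW-relabel x y z (x∈V , y∈V , z∈V , x<y , y<z , e , x≉y , z≉y) =
    V-minus⇒V-relabel x∈V , V-minus⇒V-relabel y∈V , V-minus⇒V-relabel z∈V ,
    x<y , y<z , Arc-minus⇒Arc-relabel e ,
    Incomparable-minus⇒relabel x<r y<r x≉y , Incomparable-minus⇒relabel z<r y<r z≉y
    where
    z<r = descending⇒<r (proj₁ (Arc-minus⁻ e)) (<-trans x<y y<z)
    y<r = <-trans y<z z<r
    x<r = <-trans x<y y<r

lemma3p2 : (D : Digraph) → WellFormed D → Acyclic D → 3 ≤ length (V D)
    → (a : ℕ) → a ∈ V D → Turning D a
    → (r : ℕ) → 0 < r → r ∉ V D
    → (∀ p → InP D a p → p < r)
    → (∀ f → InF D a f → r < f)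
    → (∀ x y z → InW (D [ a ↦ r ]) x y z → x ≢ r × y ≢ r × z ≢ r)
    × (∀ x y z → InW (D [ a ↦ r ]) x y z ⇔ InW (D minus a) x y z)
lemma3p2 D wf _ _ a _ _ r _ r∉V 𝒫<r r<F =
  InW-relabel-avoids ,
  λ x y z → mk⇔ (InW-relabel⇒InW-minus x y z) (InW-minus⇒InW-relabel x y z)
  where open BetweenPredecessorsAndSuccessors D wf a r r∉V 𝒫<r r<F
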